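{- Let $\leftthreetimes\in\{\cap,\subset\}$ and let $P_\leftthreetimes$ be the unique double bialgebra morphism from $(\mathcal{F}[\mathbf{H}],m,\Delta^{(\leftthreetimes)},\delta^{(\leftthreetimes)})$ to $(\mathbb{K}[X],m,\Delta,\delta)$. Then for every hypergraph $G$ and every integer $N\geq 1$: (i) $P_\cap(G)(N)$ is the number of maps $f:V(G)\to\{1,\dots,N\}$ such that whenever $x,y$ are two distinct elements of an edge $e\in E(G)$, $f(x)\neq f(y)$; (ii) $P_\subset(G)(N)$ is the number of maps $f:V(G)\to\{1,\dots,N\}$ such that for every nontrivial edge $e\in E(G)$ (i.e. $|e|\geq 2$), $f$ takes at least two different values on $e$.
   Context: $\mathbb{K}$ is a field of characteristic zero. A hypergraph is a pair $G=(V(G),E(G))$ with $V(G)$ finite and $E(G)\subseteq\mathcal{P}(V(G))$ containing $\emptyset$ and all singletons; $E^+(G)=\{e\in E(G)\mid |e|\geq2\}$. For $I\subseteq V(G)$: $G_{\mid_\subset I}$ has vertex set $I$ and edges $\{e\in E(G)\mid e\subseteq I\}$; $G_{\mid_\cap I}$ has vertex set $I$ and edges $\{e\cap I\mid e\in E(G)\}$. $\mathcal{F}[\mathbf{H}]$ is the $\mathbb{K}$-vector space with basis the isomorphism classes of hypergraphs, with product $m$ the disjoint union ($GG'$ has vertex set $V(G)\sqcup V(G')$, edges $E(G)\cup E(G')$) and coproduct $\Delta^{(\leftthreetimes)}(G)=\sum_{I\subseteq V(G)}G_{\mid_\leftthreetimes I}\otimes G_{\mid_\leftthreetimes V(G)\setminus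 I}$. A path is a sequence of vertices with consecutive vertices in a common edge; connectedness as usual. For an equivalence $\sim$ on $V(G)$ with canonical surjection $\pi_\sim$: $G/\sim$ has vertex set $V(G)/\sim$ and edges $\{\pi_\sim(e)\mid e\in E(G)\}$; $G\mid_\leftthreetimes\sim=\prod_{C\in V(G)/\sim}G_{\mid_\leftthreetimes C}$; $\mathcal{E}_\leftthreetimes[G]$ is the set of equivalences $\sim$ such that each $G_{\mid_\leftthreetimes C}$, $C$ a class, is connected. $\delta^{(\leftthreetimes)}(G)=\sum_{\sim\in\mathcal{E}_\leftthreetimes[G]}G/\sim\otimes G\mid_\leftthreetimes\sim$. On $\mathbb{K}[X]$, $\Delta$ and $\delta$ are the multiplicative coproducts with $\Delta(X)=X\otimes1+1\otimes X$ and $\delta(X)=X\otimes X$. A double bialgebra morphism here is a linear map that is simultaneously a bialgebra morphism $(\mathcal{F}[\mathbf{H}],m,\Delta^{(\leftthreetimes)})\to(\mathbb{K}[X],m,\Delta)$ and $(\mathcal{F}[\mathbf{H}],m,\delta^{(\leftthreetimes)})\to(\mathbb{K}[X],m,\delta)$; such a morphism exists and is unique. -}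

module Defs where

open import Level using (Level; _⊔_) renaming (suc to lsuc)
open import Data.Nat using (ℕ; zero; suc; _≤ᵇ_) renaming (_+_ to _+ℕ_)
open import Data.Bool using (Bool; true; false; _∧_; _∨_; not; if_then_else_)
open import Data.Fin using (Fin; toℕ) renaming (zero to fzero; suc to fsuc; _≟_ to _≟F_)
open import Data.Vec using (Vec; []; _∷_; tabulate; take; drop) renaming (lookup to lookupV)
open import Data.Vec.Properties using (≡-dec)
open import Data.List.Base using (List; []; _∷_; _++_; map; concatMap; length; allFin; filterᵇ; foldr) renaming (lookup to lookupL)
open import Data.Bool.ListAction using (any; all)
open import Data.Product using (Σ; _,_; proj₁; proj₂)
open import Relation.Nullary using (¬_)
open import Relation.Nullary.Decidable using (⌊_⌋)
open import Relation.Binary.PropositionalEquality using (_≡_)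
open import Function.Bundles using (_↔_; Inverse)
open import Algebra.Bundles using (CommutativeRing)
import Data.Bool as B

anyFin : ∀ {n} → (Fin n → Bool) → Bool
anyFin {n} p = any p (allFin n)

allFinB : ∀ {n} → (Fin n → Bool) → Bool
allFinB {n} p = all p (allFin n)

_==F_ : ∀ {n} → Fin n → Fin n → Bool
i ==F j = ⌊ i ≟F j ⌋

_==V_ : ∀ {n} → Vec Bool n → Vec Bool n → Bool
u ==V v = ⌊ ≡-dec B._≟_ u v ⌋

allSubsets : (n : ℕ) → List (Vec Bool n)
allSubsets zero = [] ∷ []
allSubsets (suc n) = concatMap (λ v → (false ∷ v) ∷ (true ∷ v) ∷ []) (allSubsets n)

anySub : ∀ {n} → (Vec Bool n → Bool) → Bool
anySub {n} p = any p (allSubsets n)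

allSub : ∀ {n} → (Vec Bool n → Bool) → Bool
allSub {n} p = all p (allSubsets n)

allMaps : (n N : ℕ) → List (Vec (Fin N) n)
allMaps zero N = [] ∷ []
allMaps (suc n) N = concatMap (λ v → map (_∷ v) (allFin N)) (allMaps n N)

size : ∀ {n} → Vec Bool n → ℕ
size [] = 0
size (b ∷ v) = (if b then 1 else 0) +ℕ size v

isEmptyV : ∀ {n} → Vec Bool n → Bool
isEmptyV v = size v ≤ᵇ 0

elements : ∀ {n} → Vec Bool n → List (Fin n)
elements [] = []
elements (b ∷ v) = (if b then fzero ∷ [] else []) ++ map fsuc (elements v)

card : ∀ {n} → Vec Bool n → ℕ
card I = length (elements I)

ι : ∀ {n} (I : Vec Bool n) → Fin (card I) → Fin n
ι I = lookupL (elements I)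

image : ∀ {k n} → (Fin k → Fin n) → Vec Bool k → Vec Bool n
image f e = tabulate (λ i → anyFin (λ j → lookupV e j ∧ (f j ==F i)))

preimage : ∀ {k n} → (Fin k → Fin n) → Vec Bool n → Vec Bool k
preimage f e = tabulate (λ j → lookupV e (f j))

-- A hypergraph is given by a Boolean predicate `raw` on subsets; its edge set
-- is E(G) = {e | raw e} ∪ {∅} ∪ {singletons}, so that E(G) always contains ∅
-- and all singletons.

record Hypergraph (n : ℕ) : Set where
  constructor hg
  field raw : Vec Bool n → Bool
open Hypergraph public

isEdge : ∀ {n} → Hypergraph n → Vec Bool n → Bool
isEdge G e = raw G e ∨ (size e ≤ᵇ 1)

isNontrivEdge : ∀ {n} → Hypergraph n → Vec Bool n → Bool
isNontrivEdge G e = isEdge G e ∧ (2 ≤ᵇ size e)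

Isomorphic : ∀ {n m} → Hypergraph n → Hypergraph m → Set
Isomorphic {n} {m} G H =
  Σ (Fin n ↔ Fin m) λ σ → ∀ (e : Vec Bool m) → isEdge H e ≡ isEdge G (preimage (Inverse.to σ) e)

emptyHG : Hypergraph 0
emptyHG = hg (λ _ → false)

-- disjoint union (product of F[H]); vertices of G come first
_⊔H_ : ∀ {n m} → Hypergraph n → Hypergraph m → Hypergraph (n +ℕ m)
_⊔H_ {n} {m} G H = hg (λ e →
  (isEdge G (take n e) ∧ isEmptyV (drop n e)) ∨ (isEmptyV (take n e) ∧ isEdge H (drop n e)))

prodList : List (Σ ℕ Hypergraph) → Σ ℕ Hypergraph
prodList = foldr (λ G H → (proj₁ G +ℕ proj₁ H) , (proj₂ G ⊔H proj₂ H)) (0 , emptyHG)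

data Variant : Set where
  cap sub : Variant

-- G|_⊂ I : edges of G contained in I
restrictSub : ∀ {n} → Hypergraph n → (I : Vec Bool n) → Hypergraph (card I)
restrictSub G I = hg (λ e' → isEdge G (image (ι I) e'))

-- G|_∩ I : traces e ∩ I of edges of G
restrictCap : ∀ {n} → Hypergraph n → (I : Vec Bool n) → Hypergraph (card I)
restrictCap G I = hg (λ e' → anySub (λ e → isEdge G e ∧ (preimage (ι I) e ==V e')))

restrict : Variant → ∀ {n} → Hypergraph n → (I : Vec Bool n) → Hypergraph (card I)
restrict cap = restrictCap
restrict sub = restrictSub

complement : ∀ {n} → Vec Bool n → Vec Bool n
complement v = Data.Vec.map not v

adjacent : ∀ {m} → Hypergraph m → Fin m → Fin m → Bool
adjacent H x y = anySub (λ e → isEdge H e ∧ lookupV e x ∧ lookupV e y)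

reach : ∀ {m} → Hypergraph m → ℕ → Fin m → Fin m → Bool
reach H zero x y = x ==F y
reach H (suc k) x y = reach H k x y ∨ anyFin (λ z → reach H k x z ∧ adjacent H z y)

connected : ∀ {m} → Hypergraph m → Bool
connected {m} H = allFinB (λ x → allFinB (λ y → reach H m x y))

-- Equivalence relations on Fin n, represented canonically by the map
-- sending each vertex to the least element of its class.

isCanonical : ∀ {n} → Vec (Fin n) n → Bool
isCanonical f = allFinB (λ i →
  (lookupV f (lookupV f i) ==F lookupV f i) ∧ (toℕ (lookupV f i) ≤ᵇ toℕ i))

reps : ∀ {n} → Vec (Fin n) n → Vec Bool n
reps f = tabulate (λ i → lookupV f i ==F i)

classOf : ∀ {n} → Vec (Fin n) n → Fin n → Vec Bool n
classOf f c = tabulate (λ i → lookupV f i ==F c)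

-- G/∼ : vertex set V(G)/∼ (enumerated by the representatives), edges π(e)
quotientHG : ∀ {n} → Hypergraph n → (f : Vec (Fin n) n) → Hypergraph (card (reps f))
quotientHG G f = hg (λ e' → anySub (λ e → isEdge G e ∧ (image (lookupV f) e ==V image (ι (reps f)) e')))

-- G|_⋌ ∼ = ∏_{C class} G|_⋌ C
restrictEquiv : Variant → ∀ {n} → Hypergraph n → Vec (Fin n) n → Σ ℕ Hypergraph
restrictEquiv v G f = prodList (map (λ c → card (classOf f c) , restrict v G (classOf f c)) (elements (reps f)))

inE : Variant → ∀ {n} → Hypergraph n → Vec (Fin n) n → Bool
inE v G f = isCanonical f ∧ all (λ c → connected (restrict v G (classOf f c))) (elements (reps f))

EList : Variant → ∀ {n} → Hypergraph n → List (Vec (Fin n) n)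
EList v {n} G = filterᵇ (inE v G) (allMaps n n)

properCap : ∀ {n N} → Hypergraph n → Vec (Fin N) n → Bool
properCap G f = allSub (λ e → not (isEdge G e) ∨
  allFinB (λ x → allFinB (λ y →
    not (lookupV e x ∧ lookupV e y ∧ not (x ==F y)) ∨ not (lookupV f x ==F lookupV f y))))

properSub : ∀ {n N} → Hypergraph n → Vec (Fin N) n → Bool
properSub G f = allSub (λ e → not (isNontrivEdge G e) ∨
  anyFin (λ x → anyFin (λ y → lookupV e x ∧ lookupV e y ∧ not (lookupV f x ==F lookupV f y))))

countCap : ∀ {n} → Hypergraph n → ℕ → ℕ
countCap {n} G N = length (filterᵇ (properCap G) (allMaps n N))

countSub : ∀ {n} → Hypergraph n → ℕ → ℕ
countSub {n} G N = length (filterᵇ (properSub G) (allMaps n N))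

record Field (c ℓ : Level) : Set (lsuc (c ⊔ ℓ)) where
  field commutativeRing : CommutativeRing c ℓ
  open CommutativeRing commutativeRing public
  field
    1≉0 : ¬ (1# ≈ 0#)
    inverse : ∀ x → ¬ (x ≈ 0#) → Σ Carrier λ y → x * y ≈ 1#

module _ {c ℓ : Level} (K : Field c ℓ) where
  open Field K

  fromℕ : ℕ → Carrier
  fromℕ zero = 0#
  fromℕ (suc n) = 1# + fromℕ n

  CharZero : Set ℓ
  CharZero = ∀ n → ¬ (fromℕ (suc n) ≈ 0#)

  -- K[X]: coefficient lists (constant term first)
  Poly : Set c
  Poly = List Carrier

  eval : Poly → Carrier → Carrier
  eval [] x = 0#
  eval (a ∷ p) x = a + x * eval p x

  sumK : List Carrier → Carrier
  sumK = foldr _+_ 0#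

  boolK : Bool → Carrier
  boolK b = if b then 1# else 0#

  -- A linear map F[H] → K[X] is given by its values on (iso classes of) hypergraphs.
  -- Identities in K[X] and K[X]⊗K[X] ≅ K[X,Y] are expressed by evaluation
  -- (K is infinite since char K = 0).
  record IsDoubleBialgebraMorphism (v : Variant) (φ : ∀ {n} → Hypergraph n → Poly) : Set (c ⊔ ℓ) where
    field
      iso-invariant : ∀ {n m} (G : Hypergraph n) (H : Hypergraph m) → Isomorphic G H →
                      ∀ x → eval (φ G) x ≈ eval (φ H) x
      unit : ∀ x → eval (φ emptyHG) x ≈ 1#
      mult : ∀ {n m} (G : Hypergraph n) (H : Hypergraph m) →
             ∀ x → eval (φ (G ⊔H H)) x ≈ eval (φ G) x * eval (φ H) x
      -- coalgebra morphism for Δ^(⋌) → Δ, Δ(P)(X,Y) = P(X+Y), ε(P) = P(0)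
      Δ-compat : ∀ {n} (G : Hypergraph n) → ∀ x y →
        eval (φ G) (x + y) ≈
        sumK (map (λ I → eval (φ (restrict v G I)) x * eval (φ (restrict v G (complement I))) y) (allSubsets n))
      ε-compat : ∀ {n} (G : Hypergraph n) → eval (φ G) 0# ≈ boolK (n Data.Nat.≡ᵇ 0)
      -- coalgebra morphism for δ^(⋌) → δ, δ(P)(X,Y) = P(XY), ε'(P) = P(1)
      δ-compat : ∀ {n} (G : Hypergraph n) → ∀ x y →
        eval (φ G) (x * y) ≈
        sumK (map (λ f → eval (φ (quotientHG G f)) x * eval (φ (proj₂ (restrictEquiv v G f))) y) (EList v G))
      ε'-compat : ∀ {n} (G : Hypergraph n) → eval (φ G) 1# ≈ boolK (not (anySub (isNontrivEdge G)))

-- P(G)(N + 1) is computed from Δ-compatibility at (X, Y) = (N, 1): the term of a subset I is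
-- P(G|I)(N) · P(G|V∖I)(1), and ε'-compatibility says P(H)(1) is 1 if H has no edge of size ≥ 2
-- and 0 otherwise. Colourings are counted by the same recursion: a colouring with colours
-- {0, …, N} is determined by the set I of vertices with a nonzero colour and a colouring of I with
-- N colours; it is proper for G exactly when that colouring is proper for G|I and V∖I, where
-- everything has colour 0, spans no edge of size ≥ 2 of G|V∖I. Together with P(G)(0) = ε(G),
-- induction on N gives the claim, for every N (also N = 0) and without using the characteristic.

module Submission where

open import Defs
open import Level using (Level)
open import Data.Nat using (ℕ; _≤_)
open import Data.Product using (_×_; _,_)

module Colourings where
  open import Data.Nat using (zero; suc; _+_; _≤ᵇ_; _≡ᵇ_; z≤n; s≤s)
  open import Data.Nat.Properties
    using (≤ᵇ⇒≤; ≤⇒≤ᵇ; ≤-trans; m≤n+m; +-assoc; +-identityʳ; +-commutativeSemigroup)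
    renaming (suc-injective to ℕ-suc-injective)
  open import Algebra.Properties.CommutativeSemigroup +-commutativeSemigroup using (interchange)
  open import Data.Bool using (Bool; true; false; if_then_else_; _∧_; _∨_; not; T)
  open import Data.Bool.ListAction using (any; all)
  open import Data.Bool.Properties using (T-∧; T-∨; T-≡; T?)
  open import Data.Fin using (Fin; toℕ; cast) renaming (zero to fzero; suc to fsuc)
  open import Data.Fin.Properties using (toℕ-injective; toℕ-cast; suc-injective; any?)
  open import Data.Vec using (Vec; []; _∷_; lookup; toList)
  open import Data.Vec.Properties using (lookup∘tabulate; lookup-map; length-toList; tabulate∘lookup; tabulate-cong)
  open import Data.List.Base
    using (List; []; _∷_; _++_; map; allFin; concatMap; length; filterᵇ) renaming (lookup to lookupL)
  open import Data.List.Properties using (length-map; map-tabulate)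
  open import Data.List.Membership.Propositional using (_∈_)
  open import Data.List.Membership.Propositional.Properties
    using (∈-allFin; ∈-concatMap⁺; ∈-map⁺; ∈-map⁻; ∈-lookup)
  open import Data.List.Relation.Unary.Any as Any using (here; there; satisfied; index)
  open import Data.List.Relation.Unary.Any.Properties using (any⁺; any⁻; lookup-index)
  open import Data.List.Relation.Unary.All as All using ()
  open import Data.List.Relation.Unary.All.Properties using (all⁺; all⁻)
  open import Data.Product using (∃; ∃₂; proj₁; proj₂)
  open import Data.Sum using (_⊎_; inj₁; inj₂)
  open import Data.Unit using (tt)
  open import Data.Empty using (⊥; ⊥-elim)
  open import Function using (_∘_; id; case_of_; Equivalence; Injective)
  open import Relation.Nullary using (¬_; yes; no; contradiction; _×-dec_; ¬?)
  open import Relation.Nullary.Decidable using (toWitness; fromWitness; decidable-stable)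
  open import Relation.Binary.PropositionalEquality

  private variable
    a b : Level
    A B : Set a
    k n N : ℕ

  T-ext : ∀ {x y} → (T x → T y) → (T y → T x) → x ≡ y
  T-ext {false} {false} _ _ = refl
  T-ext {false} {true} _ y⇒x = ⊥-elim (y⇒x tt)
  T-ext {true} {false} x⇒y _ = ⊥-elim (x⇒y tt)
  T-ext {true} {true} _ _ = refl

  T-not⁺ : ∀ {x} → ¬ T x → T (not x)
  T-not⁺ {false} _ = tt
  T-not⁺ {true} ¬x = ¬x tt

  T-not⁻ : ∀ {x} → T (not x) → ¬ T x
  T-not⁻ {false} _ ()

  T-impl⁺ : ∀ {x y} → (T x → T y) → T (not x ∨ y)
  T-impl⁺ {false} _ = tt
  T-impl⁺ {true} x⇒y = x⇒y tt

  T-impl⁻ : ∀ {x y} → T (not x ∨ y) → T x → T y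
  T-impl⁻ {true} y _ = y

  ∑ : (A → ℕ) → List A → ℕ
  ∑ f [] = 0
  ∑ f (x ∷ xs) = f x + ∑ f xs

  ∑-cong : {f g : A → ℕ} → (∀ x → f x ≡ g x) → ∀ xs → ∑ f xs ≡ ∑ g xs
  ∑-cong f≗g [] = refl
  ∑-cong f≗g (x ∷ xs) = cong₂ _+_ (f≗g x) (∑-cong f≗g xs)

  ∑-zero : (xs : List A) → ∑ (λ _ → 0) xs ≡ 0
  ∑-zero [] = refl
  ∑-zero (x ∷ xs) = ∑-zero xs

  ∑-+ : (f g : A → ℕ) (xs : List A) → ∑ (λ x → f x + g x) xs ≡ ∑ f xs + ∑ g xs
  ∑-+ f g [] = refl
  ∑-+ f g (x ∷ xs) = trans (cong (f x + g x +_) (∑-+ f g xs)) (interchange (f x) (g x) _ _)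

  ∑-++ : (f : A → ℕ) (xs ys : List A) → ∑ f (xs ++ ys) ≡ ∑ f xs + ∑ f ys
  ∑-++ f [] ys = refl
  ∑-++ f (x ∷ xs) ys = trans (cong (f x +_) (∑-++ f xs ys)) (sym (+-assoc (f x) _ _))

  ∑-map : (f : B → ℕ) (g : A → B) (xs : List A) → ∑ f (map g xs) ≡ ∑ (f ∘ g) xs
  ∑-map f g [] = refl
  ∑-map f g (x ∷ xs) = cong (f (g x) +_) (∑-map f g xs)

  ∑-concatMap : (f : B → ℕ) (g : A → List B) (xs : List A) →
                ∑ f (concatMap g xs) ≡ ∑ (λ x → ∑ f (g x)) xs
  ∑-concatMap f g [] = refl
  ∑-concatMap f g (x ∷ xs) = trans (∑-++ f (g x) (concatMap g xs)) (cong (∑ f (g x) +_) (∑-concatMap f g xs))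

  ∑-swap : (f : A → B → ℕ) (xs : List A) (ys : List B) →
           ∑ (λ x → ∑ (f x) ys) xs ≡ ∑ (λ y → ∑ (λ x → f x y) xs) ys
  ∑-swap f [] ys = sym (∑-zero ys)
  ∑-swap f (x ∷ xs) ys = trans (cong (∑ (f x) ys +_) (∑-swap f xs ys)) (sym (∑-+ (f x) _ ys))

  ∑-if : (r : Bool) (f : A → ℕ) (xs : List A) →
         ∑ (λ x → if r then f x else 0) xs ≡ (if r then ∑ f xs else 0)
  ∑-if true f xs = refl
  ∑-if false f xs = ∑-zero xs

  ∑-allFin-suc : ∀ {N} (f : Fin (suc N) → ℕ) → ∑ f (allFin (suc N)) ≡ f fzero + ∑ (f ∘ fsuc) (allFin N)
  ∑-allFin-suc {N} f =
    cong (f fzero +_) (trans (cong (∑ f) (sym (map-tabulate id fsuc))) (∑-map f fsuc (allFin N)))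

  indicator : Bool → ℕ
  indicator b = if b then 1 else 0

  length-filterᵇ : (p : A → Bool) (xs : List A) → length (filterᵇ p xs) ≡ ∑ (indicator ∘ p) xs
  length-filterᵇ p [] = refl
  length-filterᵇ p (x ∷ xs) with p x
  ... | true = cong suc (length-filterᵇ p xs)
  ... | false = length-filterᵇ p xs

  module _ {xs : List A} (complete : ∀ x → x ∈ xs) (p : A → Bool) where

    T-all⁺ : (∀ x → T (p x)) → T (all p xs)
    T-all⁺ h = all⁻ p {xs = xs} (All.tabulate (λ {x} _ → h x))

    T-all⁻ : T (all p xs) → ∀ x → T (p x)
    T-all⁻ h x = All.lookup (all⁺ p xs h) (complete x)

    T-any⁺ : ∀ x → T (p x) → T (any p xs)
    T-any⁺ x px = any⁺ p (Any.map (λ { refl → px }) (complete x))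

    T-any⁻ : T (any p xs) → ∃ λ x → T (p x)
    T-any⁻ h = satisfied (any⁻ p xs h)

  ∈-allSubsets : (v : Vec Bool n) → v ∈ allSubsets n
  ∈-allSubsets [] = here refl
  ∈-allSubsets (false ∷ v) = ∈-concatMap⁺ _ (Any.map (λ { refl → here refl }) (∈-allSubsets v))
  ∈-allSubsets (true ∷ v) = ∈-concatMap⁺ _ (Any.map (λ { refl → there (here refl) }) (∈-allSubsets v))

  module _ {p : Fin n → Bool} where

    allFinB⁺ : (∀ x → T (p x)) → T (allFinB p)
    allFinB⁺ = T-all⁺ ∈-allFin p

    allFinB⁻ : T (allFinB p) → ∀ x → T (p x)
    allFinB⁻ = T-all⁻ ∈-allFin p

    anyFin⁺ : ∀ x → T (p x) → T (anyFin p)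
    anyFin⁺ = T-any⁺ ∈-allFin p

    anyFin⁻ : T (anyFin p) → ∃ λ x → T (p x)
    anyFin⁻ = T-any⁻ ∈-allFin p

  module _ {p : Vec Bool n → Bool} where

    allSub⁺ : (∀ e → T (p e)) → T (allSub p)
    allSub⁺ = T-all⁺ ∈-allSubsets p

    allSub⁻ : T (allSub p) → ∀ e → T (p e)
    allSub⁻ = T-all⁻ ∈-allSubsets p

    anySub⁺ : ∀ e → T (p e) → T (anySub p)
    anySub⁺ = T-any⁺ ∈-allSubsets p

    anySub⁻ : T (anySub p) → ∃ λ e → T (p e)
    anySub⁻ = T-any⁻ ∈-allSubsets p

  infix 4 _∈ₛ_
  _∈ₛ_ : Fin n → Vec Bool n → Set
  x ∈ₛ e = T (lookup e x)

  _⊆ₛ_ : Vec Bool n → Vec Bool n → Set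
  e ⊆ₛ I = ∀ {x} → x ∈ₛ e → x ∈ₛ I

  ∈-elements⁺ : (I : Vec Bool n) {x : Fin n} → x ∈ₛ I → x ∈ elements I
  ∈-elements⁺ (true ∷ I) {fzero} _ = here refl
  ∈-elements⁺ (false ∷ I) {fsuc x} x∈I = ∈-map⁺ fsuc (∈-elements⁺ I x∈I)
  ∈-elements⁺ (true ∷ I) {fsuc x} x∈I = there (∈-map⁺ fsuc (∈-elements⁺ I x∈I))

  ∈-elements⁻ : (I : Vec Bool n) {x : Fin n} → x ∈ elements I → x ∈ₛ I
  ∈-elements⁻ (true ∷ I) (here refl) = tt
  ∈-elements⁻ (true ∷ I) (there x∈) with ∈-map⁻ fsuc x∈
  ... | y , y∈ , refl = ∈-elements⁻ I y∈
  ∈-elements⁻ (false ∷ I) x∈ with ∈-map⁻ fsuc x∈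
  ... | y , y∈ , refl = ∈-elements⁻ I y∈

  lookup-map-cast : (f : A → B) (xs : List A) (k : Fin (length (map f xs))) →
                    lookupL (map f xs) k ≡ f (lookupL xs (cast (length-map f xs) k))
  lookup-map-cast f (x ∷ xs) fzero = refl
  lookup-map-cast f (x ∷ xs) (fsuc k) = lookup-map-cast f xs k

  ι-∈ : (I : Vec Bool n) (k : Fin (card I)) → ι I k ∈ₛ I
  ι-∈ I k = ∈-elements⁻ I (∈-lookup k)

  ι-onto : (I : Vec Bool n) {x : Fin n} → x ∈ₛ I → ∃ λ k → ι I k ≡ x
  ι-onto I x∈I = let x∈ = ∈-elements⁺ I x∈I in index x∈ , sym (lookup-index x∈)

  ι-injective : (I : Vec Bool n) → Injective _≡_ _≡_ (ι I)
  ι-injective (false ∷ I) {a} {b} eq = cast-injective (ι-injective I (suc-injective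
    (trans (sym (lookup-map-cast fsuc (elements I) a)) (trans eq (lookup-map-cast fsuc (elements I) b)))))
    where
    cast-injective : ∀ {m n} .{eq : m ≡ n} {a b : Fin m} → cast eq a ≡ cast eq b → a ≡ b
    cast-injective {eq = eq} {a} {b} p =
      toℕ-injective (trans (sym (toℕ-cast eq a)) (trans (cong toℕ p) (toℕ-cast eq b)))
  ι-injective (true ∷ I) {fzero} {fzero} _ = refl
  ι-injective (true ∷ I) {fzero} {fsuc b} eq with trans eq (lookup-map-cast fsuc (elements I) b)
  ... | ()
  ι-injective (true ∷ I) {fsuc a} {fzero} eq with trans (sym (lookup-map-cast fsuc (elements I) a)) eq
  ... | ()
  ι-injective (true ∷ I) {fsuc a} {fsuc b} eq = cong fsuc (ι-injective (false ∷ I) eq)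

  module _ {m : ℕ} (f : Fin k → Fin m) where

    ∈-preimage⁺ : (e : Vec Bool m) {j : Fin k} → f j ∈ₛ e → j ∈ₛ preimage f e
    ∈-preimage⁺ e {j} = subst T (sym (lookup∘tabulate _ j))

    ∈-preimage⁻ : (e : Vec Bool m) {j : Fin k} → j ∈ₛ preimage f e → f j ∈ₛ e
    ∈-preimage⁻ e {j} = subst T (lookup∘tabulate _ j)

    ∈-image⁺ : (e : Vec Bool k) {j : Fin k} → j ∈ₛ e → f j ∈ₛ image f e
    ∈-image⁺ e {j} j∈e = subst T (sym (lookup∘tabulate _ (f j)))
      (anyFin⁺ j (Equivalence.from T-∧ (j∈e , fromWitness refl)))

    ∈-image⁻ : (e : Vec Bool k) {i : Fin m} → i ∈ₛ image f e → ∃ λ j → j ∈ₛ e × f j ≡ i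
    ∈-image⁻ e {i} i∈ with anyFin⁻ (subst T (lookup∘tabulate _ i) i∈)
    ... | j , j∈e∧fj≡i with Equivalence.to T-∧ j∈e∧fj≡i
    ... | j∈e , fj≡i = j , j∈e , toWitness fj≡i

  ∈-complement⁺ : (I : Vec Bool n) {x : Fin n} → ¬ x ∈ₛ I → x ∈ₛ complement I
  ∈-complement⁺ I {x} x∉I = subst T (sym (lookup-map x not I)) (T-not⁺ x∉I)

  ∈-complement⁻ : (I : Vec Bool n) {x : Fin n} → x ∈ₛ complement I → ¬ x ∈ₛ I
  ∈-complement⁻ I {x} x∈ = T-not⁻ (subst T (lookup-map x not I) x∈)

  ⊆ₛ-or-∉ : (e I : Vec Bool n) → e ⊆ₛ I ⊎ ∃ λ x → x ∈ₛ e × ¬ x ∈ₛ I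
  ⊆ₛ-or-∉ e I with any? (λ x → T? (lookup e x) ×-dec ¬? (T? (lookup I x)))
  ... | yes witness = inj₂ witness
  ... | no none = inj₁ λ {x} x∈e → decidable-stable (T? (lookup I x)) λ x∉I → none (x , x∈e , x∉I)

  ∉-complement⁻ : (I : Vec Bool n) {x : Fin n} → ¬ x ∈ₛ complement I → x ∈ₛ I
  ∉-complement⁻ I {x} x∉Ic = decidable-stable (T? (lookup I x)) (x∉Ic ∘ ∈-complement⁺ I)

  image-ι-preimage-ι : (I e : Vec Bool n) → e ⊆ₛ I → image (ι I) (preimage (ι I) e) ≡ e
  image-ι-preimage-ι I e e⊆I =
    trans (sym (tabulate∘lookup _)) (trans (tabulate-cong λ x → T-ext (to x) (from x)) (tabulate∘lookup e))
    where
    to : ∀ x → x ∈ₛ image (ι I) (preimage (ι I) e) → x ∈ₛ e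
    to x x∈ with ∈-image⁻ (ι I) (preimage (ι I) e) x∈
    ... | k , k∈ , refl = ∈-preimage⁻ (ι I) e {k} k∈
    from : ∀ x → x ∈ₛ e → x ∈ₛ image (ι I) (preimage (ι I) e)
    from x x∈e with ι-onto I (e⊆I x∈e)
    ... | k , refl = ∈-image⁺ (ι I) (preimage (ι I) e) (∈-preimage⁺ (ι I) e x∈e)

  Nontrivial : Vec Bool n → Set
  Nontrivial e = ∃₂ λ x y → x ∈ₛ e × y ∈ₛ e × x ≢ y

  ∈⇒1≤size : (e : Vec Bool n) {x : Fin n} → x ∈ₛ e → 1 ≤ size e
  ∈⇒1≤size (true ∷ e) {fzero} _ = s≤s z≤n
  ∈⇒1≤size (b ∷ e) {fsuc x} x∈e = ≤-trans (∈⇒1≤size e x∈e) (m≤n+m (size e) _)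

  1≤size⇒∈ : (e : Vec Bool n) → 1 ≤ size e → ∃ λ x → x ∈ₛ e
  1≤size⇒∈ (true ∷ e) _ = fzero , tt
  1≤size⇒∈ (false ∷ e) 1≤ with 1≤size⇒∈ e 1≤
  ... | x , x∈e = fsuc x , x∈e

  nontrivial⇒2≤size : (e : Vec Bool n) → Nontrivial e → 2 ≤ size e
  nontrivial⇒2≤size (b ∷ e) (fzero , fzero , _ , _ , x≢y) = contradiction refl x≢y
  nontrivial⇒2≤size (true ∷ e) (fzero , fsuc y , _ , y∈e , _) = s≤s (∈⇒1≤size e y∈e)
  nontrivial⇒2≤size (true ∷ e) (fsuc x , fzero , x∈e , _ , _) = s≤s (∈⇒1≤size e x∈e)
  nontrivial⇒2≤size (b ∷ e) (fsuc x , fsuc y , x∈e , y∈e , x≢y) =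
    ≤-trans (nontrivial⇒2≤size e (x , y , x∈e , y∈e , x≢y ∘ cong fsuc)) (m≤n+m (size e) _)

  2≤size⇒nontrivial : (e : Vec Bool n) → 2 ≤ size e → Nontrivial e
  2≤size⇒nontrivial (true ∷ e) (s≤s 1≤) with 1≤size⇒∈ e 1≤
  ... | y , y∈e = fzero , fsuc y , tt , y∈e , λ ()
  2≤size⇒nontrivial (false ∷ e) 2≤ with 2≤size⇒nontrivial e 2≤
  ... | x , y , x∈e , y∈e , x≢y = fsuc x , fsuc y , x∈e , y∈e , x≢y ∘ suc-injective

  module _ (G : Hypergraph n) (e : Vec Bool n) where

    isNontrivEdge⁺ : T (isEdge G e) → Nontrivial e → T (isNontrivEdge G e)
    isNontrivEdge⁺ e∈G nt = Equivalence.from T-∧ (e∈G , ≤⇒≤ᵇ (nontrivial⇒2≤size e nt))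

    isNontrivEdge⁻ : T (isNontrivEdge G e) → T (isEdge G e) × Nontrivial e
    isNontrivEdge⁻ h with Equivalence.to T-∧ h
    ... | e∈G , 2≤ = e∈G , 2≤size⇒nontrivial e (≤ᵇ⇒≤ 2 (size e) 2≤)

    raw-nontrivial : T (isEdge G e) → Nontrivial e → T (raw G e)
    raw-nontrivial e∈G nt with Equivalence.to T-∨ e∈G
    ... | inj₁ r = r
    ... | inj₂ ≤1 with ≤-trans (nontrivial⇒2≤size e nt) (≤ᵇ⇒≤ (size e) 1 ≤1)
    ... | s≤s ()

  module _ (G : Hypergraph n) (f : Vec (Fin N) n) where

    InjectiveOnEdges : Set
    InjectiveOnEdges =
      ∀ e → T (isEdge G e) → ∀ {x y} → x ∈ₛ e → y ∈ₛ e → x ≢ y → lookup f x ≢ lookup f y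

    NonConstantOnNontrivialEdges : Set
    NonConstantOnNontrivialEdges =
      ∀ e → T (isNontrivEdge G e) → ∃₂ λ x y → x ∈ₛ e × y ∈ₛ e × lookup f x ≢ lookup f y

    properCap⁺ : InjectiveOnEdges → T (properCap G f)
    properCap⁺ inj = allSub⁺ λ e → T-impl⁺ {isEdge G e} λ e∈G →
      allFinB⁺ λ x → allFinB⁺ λ y → T-impl⁺ {lookup e x ∧ lookup e y ∧ not (x ==F y)} λ x,y∈e,x≢y →
        let x∈e , y∈e,x≢y = Equivalence.to T-∧ x,y∈e,x≢y
            y∈e , x≢y = Equivalence.to T-∧ y∈e,x≢y
        in T-not⁺ λ fx≡fy → inj e e∈G x∈e y∈e (T-not⁻ x≢y ∘ fromWitness) (toWitness fx≡fy)

    properCap⁻ : T (properCap G f) → InjectiveOnEdges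
    properCap⁻ proper e e∈G {x} {y} x∈e y∈e x≢y fx≡fy =
      T-not⁻ (T-impl⁻ (allFinB⁻ (allFinB⁻ (T-impl⁻ (allSub⁻ proper e) e∈G) x) y)
                      (Equivalence.from T-∧ (x∈e , Equivalence.from T-∧ (y∈e , T-not⁺ (x≢y ∘ toWitness)))))
             (fromWitness fx≡fy)

    properSub⁺ : NonConstantOnNontrivialEdges → T (properSub G f)
    properSub⁺ nonconst = allSub⁺ λ e → T-impl⁺ λ nt →
      let x , y , x∈e , y∈e , fx≢fy = nonconst e nt
      in anyFin⁺ x (anyFin⁺ y
           (Equivalence.from T-∧ (x∈e , Equivalence.from T-∧ (y∈e , T-not⁺ (fx≢fy ∘ toWitness)))))

    properSub⁻ : T (properSub G f) → NonConstantOnNontrivialEdges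
    properSub⁻ proper e nt with anyFin⁻ (T-impl⁻ (allSub⁻ proper e) nt)
    ... | x , h with anyFin⁻ h
    ... | y , x,y∈e,fx≢fy =
      let x∈e , y∈e,fx≢fy = Equivalence.to T-∧ x,y∈e,fx≢fy
          y∈e , fx≢fy = Equivalence.to T-∧ y∈e,fx≢fy
      in x , y , x∈e , y∈e , T-not⁻ fx≢fy ∘ fromWitness

  module _ (G : Hypergraph n) (I : Vec Bool n) where

    isEdge-restrictCap-preimage : ∀ e → T (isEdge G e) → T (isEdge (restrictCap G I) (preimage (ι I) e))
    isEdge-restrictCap-preimage e e∈G =
      Equivalence.from T-∨ (inj₁ (anySub⁺ e (Equivalence.from T-∧ (e∈G , fromWitness refl))))

    nontrivialEdge-restrictCap⁻ : ∀ e' → T (isEdge (restrictCap G I) e') → Nontrivial e' →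
                                  ∃ λ e → T (isEdge G e) × preimage (ι I) e ≡ e'
    nontrivialEdge-restrictCap⁻ e' e'∈ nt with anySub⁻ (raw-nontrivial (restrictCap G I) e' e'∈ nt)
    ... | e , h with Equivalence.to T-∧ h
    ... | e∈G , eq = e , e∈G , toWitness eq

    nontrivialEdge-restrictSub⁻ : ∀ e' → T (isNontrivEdge (restrictSub G I) e') →
                                  T (isNontrivEdge G (image (ι I) e'))
    nontrivialEdge-restrictSub⁻ e' nt with isNontrivEdge⁻ (restrictSub G I) e' nt
    ... | e'∈ , x , y , x∈e' , y∈e' , x≢y =
      isNontrivEdge⁺ G (image (ι I) e') (raw-nontrivial (restrictSub G I) e' e'∈ (x , y , x∈e' , y∈e' , x≢y))
        (ι I x , ι I y , ∈-image⁺ (ι I) e' x∈e' , ∈-image⁺ (ι I) e' y∈e' , x≢y ∘ ι-injective I)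

    nontrivialEdge-restrictSub⁺ : ∀ e → T (isNontrivEdge G e) → e ⊆ₛ I →
                                  T (isNontrivEdge (restrictSub G I) (preimage (ι I) e))
    nontrivialEdge-restrictSub⁺ e nt e⊆I with isNontrivEdge⁻ G e nt
    ... | e∈G , x , y , x∈e , y∈e , x≢y with ι-onto I (e⊆I x∈e) | ι-onto I (e⊆I y∈e)
    ... | a , refl | b , refl =
      isNontrivEdge⁺ (restrictSub G I) (preimage (ι I) e)
        (Equivalence.from T-∨ (inj₁ (subst (T ∘ isEdge G) (sym (image-ι-preimage-ι I e e⊆I)) e∈G)))
        (a , b , ∈-preimage⁺ (ι I) e x∈e , ∈-preimage⁺ (ι I) e y∈e , x≢y ∘ cong (ι I))

  -- Only used with lists of length card I; the clause for [] is junk.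
  extendByZero : Vec Bool n → List (Fin N) → Vec (Fin (suc N)) n
  extendByZero [] _ = []
  extendByZero (false ∷ I) cs = fzero ∷ extendByZero I cs
  extendByZero (true ∷ I) [] = fzero ∷ extendByZero I []
  extendByZero (true ∷ I) (c ∷ cs) = fsuc c ∷ extendByZero I cs

  extendByZero-∉ : (I : Vec Bool n) (cs : List (Fin N)) {x : Fin n} → ¬ x ∈ₛ I →
                   lookup (extendByZero I cs) x ≡ fzero
  extendByZero-∉ (false ∷ I) cs {fzero} _ = refl
  extendByZero-∉ (true ∷ I) cs {fzero} x∉I = contradiction tt x∉I
  extendByZero-∉ (false ∷ I) cs {fsuc x} x∉I = extendByZero-∉ I cs x∉I
  extendByZero-∉ (true ∷ I) [] {fsuc x} x∉I = extendByZero-∉ I [] x∉I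
  extendByZero-∉ (true ∷ I) (c ∷ cs) {fsuc x} x∉I = extendByZero-∉ I cs x∉I

  extendByZero-ι : (I : Vec Bool n) (g : Vec (Fin N) (card I)) (k : Fin (card I)) →
                   lookup (extendByZero I (toList g)) (ι I k) ≡ fsuc (lookup g k)
  extendByZero-ι I g k =
    trans (at-position I (toList g) k _ (sym (toℕ-cast (sym (length-toList g)) k))) (cong fsuc (lookup-toList g k))
    where
    lookup-toList : ∀ {m} (g : Vec (Fin N) m) (k : Fin m) →
                    lookupL (toList g) (cast (sym (length-toList g)) k) ≡ lookup g k
    lookup-toList (c ∷ g) fzero = refl
    lookup-toList (c ∷ g) (fsuc k) = lookup-toList g k
    at-position : ∀ {n} (I : Vec Bool n) (cs : List (Fin N)) (k : Fin (card I)) (k' : Fin (length cs)) →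
                  toℕ k ≡ toℕ k' → lookup (extendByZero I cs) (ι I k) ≡ fsuc (lookupL cs k')
    at-position (false ∷ I) cs k k' eq rewrite lookup-map-cast fsuc (elements I) k =
      at-position I cs _ k' (trans (toℕ-cast _ k) eq)
    at-position (true ∷ I) (c ∷ cs) fzero fzero _ = refl
    at-position (true ∷ I) (c ∷ cs) (fsuc k) (fsuc k') eq rewrite lookup-map-cast fsuc (elements I) k =
      at-position I cs _ k' (trans (toℕ-cast _ k) (ℕ-suc-injective eq))

  isDiscrete : Hypergraph n → Bool
  isDiscrete H = not (anySub (isNontrivEdge H))

  module Extension (I : Vec Bool n) (g : Vec (Fin N) (card I)) where

    f : Vec (Fin (suc N)) n
    f = extendByZero I (toList g)

    f-ι-injective : ∀ {a b} → lookup f (ι I a) ≡ lookup f (ι I b) → lookup g a ≡ lookup g b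
    f-ι-injective {a} {b} eq = suc-injective (trans (sym (extendByZero-ι I g a)) (trans eq (extendByZero-ι I g b)))

    f-outside : ∀ k → lookup f (ι (complement I) k) ≡ fzero
    f-outside k = extendByZero-∉ I (toList g) (∈-complement⁻ I (ι-∈ (complement I) k))

    f-separates : ∀ {x y} → x ∈ₛ I → ¬ y ∈ₛ I → lookup f x ≢ lookup f y
    f-separates x∈I y∉I fx≡fy with ι-onto I x∈I
    ... | a , refl with trans (sym (extendByZero-ι I g a)) (trans fx≡fy (extendByZero-∉ I (toList g) y∉I))
    ... | ()

  module _ (G : Hypergraph n) (I : Vec Bool n) (g : Vec (Fin N) (card I)) where
    open Extension I g

    private
      Ic = complement I

    properCap-restrict : T (properCap G f) → T (properCap (restrictCap G I) g)
    properCap-restrict P = properCap⁺ (restrictCap G I) g injective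
      where
      injective : InjectiveOnEdges (restrictCap G I) g
      injective e' e'∈ {x} {y} x∈e' y∈e' x≢y gx≡gy
        with nontrivialEdge-restrictCap⁻ G I e' e'∈ (x , y , x∈e' , y∈e' , x≢y)
      ... | e , e∈G , refl =
        properCap⁻ G f P e e∈G (∈-preimage⁻ (ι I) e x∈e') (∈-preimage⁻ (ι I) e y∈e')
          (x≢y ∘ ι-injective I)
          (trans (extendByZero-ι I g x) (trans (cong fsuc gx≡gy) (sym (extendByZero-ι I g y))))

    properCap-discrete : T (properCap G f) → T (isDiscrete (restrictCap G Ic))
    properCap-discrete P = T-not⁺ λ h → let e' , nt = anySub⁻ h in noNontrivialEdge e' nt
      where
      noNontrivialEdge : ∀ e' → ¬ T (isNontrivEdge (restrictCap G Ic) e')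
      noNontrivialEdge e' nt with isNontrivEdge⁻ (restrictCap G Ic) e' nt
      ... | e'∈ , x , y , x∈e' , y∈e' , x≢y
        with nontrivialEdge-restrictCap⁻ G Ic e' e'∈ (x , y , x∈e' , y∈e' , x≢y)
      ... | e , e∈G , refl =
        properCap⁻ G f P e e∈G (∈-preimage⁻ (ι Ic) e x∈e') (∈-preimage⁻ (ι Ic) e y∈e')
          (x≢y ∘ ι-injective Ic)
          (trans (f-outside x) (sym (f-outside y)))

    properCap-extend : T (properCap (restrictCap G I) g) → T (isDiscrete (restrictCap G Ic)) → T (properCap G f)
    properCap-extend Q R = properCap⁺ G f injective
      where
      bothInside : ∀ {e x y} → T (isEdge G e) → x ∈ₛ e → y ∈ₛ e → x ≢ y → x ∈ₛ I → y ∈ₛ I →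
                   lookup f x ≢ lookup f y
      bothInside {e} e∈G x∈e y∈e x≢y x∈I y∈I with ι-onto I x∈I | ι-onto I y∈I
      ... | a , refl | b , refl =
        properCap⁻ (restrictCap G I) g Q (preimage (ι I) e) (isEdge-restrictCap-preimage G I e e∈G)
          (∈-preimage⁺ (ι I) e x∈e) (∈-preimage⁺ (ι I) e y∈e) (x≢y ∘ cong (ι I)) ∘ f-ι-injective

      bothOutside : ∀ {e x y} → T (isEdge G e) → x ∈ₛ e → y ∈ₛ e → x ≢ y → ¬ x ∈ₛ I → ¬ y ∈ₛ I → ⊥
      bothOutside {e} e∈G x∈e y∈e x≢y x∉I y∉I
        with ι-onto Ic (∈-complement⁺ I x∉I) | ι-onto Ic (∈-complement⁺ I y∉I)
      ... | a , refl | b , refl =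
        T-not⁻ R (anySub⁺ (preimage (ι Ic) e) (isNontrivEdge⁺ (restrictCap G Ic) (preimage (ι Ic) e)
          (isEdge-restrictCap-preimage G Ic e e∈G)
          (a , b , ∈-preimage⁺ (ι Ic) e x∈e , ∈-preimage⁺ (ι Ic) e y∈e , x≢y ∘ cong (ι Ic))))

      injective : InjectiveOnEdges G f
      injective e e∈G {x} {y} x∈e y∈e x≢y with T? (lookup I x) | T? (lookup I y)
      ... | yes x∈I | yes y∈I = bothInside e∈G x∈e y∈e x≢y x∈I y∈I
      ... | yes x∈I | no y∉I = f-separates x∈I y∉I
      ... | no x∉I | yes y∈I = f-separates y∈I x∉I ∘ sym
      ... | no x∉I | no y∉I = ⊥-elim (bothOutside e∈G x∈e y∈e x≢y x∉I y∉I)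

    properCap-extendByZero : properCap G f ≡ properCap (restrictCap G I) g ∧ isDiscrete (restrictCap G Ic)
    properCap-extendByZero = T-ext
      (λ P → Equivalence.from T-∧ (properCap-restrict P , properCap-discrete P))
      (λ QR → let Q , R = Equivalence.to T-∧ QR in properCap-extend Q R)

    properSub-restrict : T (properSub G f) → T (properSub (restrictSub G I) g)
    properSub-restrict P = properSub⁺ (restrictSub G I) g nonconstant
      where
      nonconstant : NonConstantOnNontrivialEdges (restrictSub G I) g
      nonconstant e' nt with properSub⁻ G f P (image (ι I) e') (nontrivialEdge-restrictSub⁻ G I e' nt)
      ... | X , Y , X∈ , Y∈ , fX≢fY with ∈-image⁻ (ι I) e' X∈ | ∈-image⁻ (ι I) e' Y∈
      ... | a , a∈e' , refl | b , b∈e' , refl =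
        a , b , a∈e' , b∈e' ,
        λ ga≡gb → fX≢fY (trans (extendByZero-ι I g a) (trans (cong fsuc ga≡gb) (sym (extendByZero-ι I g b))))

    properSub-discrete : T (properSub G f) → T (isDiscrete (restrictSub G Ic))
    properSub-discrete P = T-not⁺ λ h → let e' , nt = anySub⁻ h in noNontrivialEdge e' nt
      where
      noNontrivialEdge : ∀ e' → ¬ T (isNontrivEdge (restrictSub G Ic) e')
      noNontrivialEdge e' nt with properSub⁻ G f P (image (ι Ic) e') (nontrivialEdge-restrictSub⁻ G Ic e' nt)
      ... | X , Y , X∈ , Y∈ , fX≢fY with ∈-image⁻ (ι Ic) e' X∈ | ∈-image⁻ (ι Ic) e' Y∈
      ... | a , _ , refl | b , _ , refl = fX≢fY (trans (f-outside a) (sym (f-outside b)))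

    properSub-extend : T (properSub (restrictSub G I) g) → T (isDiscrete (restrictSub G Ic)) → T (properSub G f)
    properSub-extend Q R = properSub⁺ G f nonconstant
      where
      inside : ∀ {e} → T (isNontrivEdge G e) → e ⊆ₛ I →
               ∃₂ λ x y → x ∈ₛ e × y ∈ₛ e × lookup f x ≢ lookup f y
      inside {e} nt e⊆I
        with properSub⁻ (restrictSub G I) g Q (preimage (ι I) e) (nontrivialEdge-restrictSub⁺ G I e nt e⊆I)
      ... | a , b , a∈ , b∈ , ga≢gb =
        ι I a , ι I b , ∈-preimage⁻ (ι I) e a∈ , ∈-preimage⁻ (ι I) e b∈ , ga≢gb ∘ f-ι-injective

      nonconstant : NonConstantOnNontrivialEdges G f
      nonconstant e nt with ⊆ₛ-or-∉ e I
      ... | inj₁ e⊆I = inside nt e⊆I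
      ... | inj₂ (y , y∈e , y∉I) with ⊆ₛ-or-∉ e Ic
      ... | inj₁ e⊆Ic =
        ⊥-elim (T-not⁻ R (anySub⁺ (preimage (ι Ic) e) (nontrivialEdge-restrictSub⁺ G Ic e nt e⊆Ic)))
      ... | inj₂ (x , x∈e , x∉Ic) = x , y , x∈e , y∈e , f-separates (∉-complement⁻ I x∉Ic) y∉I

    properSub-extendByZero : properSub G f ≡ properSub (restrictSub G I) g ∧ isDiscrete (restrictSub G Ic)
    properSub-extendByZero = T-ext
      (λ P → Equivalence.from T-∧ (properSub-restrict P , properSub-discrete P))
      (λ QR → let Q , R = Equivalence.to T-∧ QR in properSub-extend Q R)

  ∑-allMaps-suc : (F : List (Fin N) → ℕ) →
                  ∑ (F ∘ toList) (allMaps (suc k) N) ≡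
                  ∑ (λ g → ∑ (λ c → F (c ∷ toList g)) (allFin N)) (allMaps k N)
  ∑-allMaps-suc {N} {k} F = begin
    ∑ (F ∘ toList) (concatMap (λ g → map (_∷ g) (allFin N)) (allMaps k N))
      ≡⟨ ∑-concatMap (F ∘ toList) _ (allMaps k N) ⟩
    ∑ (λ g → ∑ (F ∘ toList) (map (_∷ g) (allFin N))) (allMaps k N)
      ≡⟨ ∑-cong (λ g → ∑-map (F ∘ toList) (_∷ g) (allFin N)) (allMaps k N) ⟩
    ∑ (λ g → ∑ (λ c → F (c ∷ toList g)) (allFin N)) (allMaps k N) ∎
    where open ≡-Reasoning

  ∑-allMaps-extendByZero : (h : Vec (Fin (suc N)) n → ℕ) →
    ∑ h (allMaps n (suc N)) ≡ ∑ (λ I → ∑ (h ∘ extendByZero I ∘ toList) (allMaps (card I) N)) (allSubsets n)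
  ∑-allMaps-extendByZero {N} {zero} h = sym (+-identityʳ _)
  ∑-allMaps-extendByZero {N} {suc n} h = begin
    ∑ h (allMaps (suc n) (suc N))
      ≡⟨ ∑-concatMap h _ (allMaps n (suc N)) ⟩
    ∑ (λ v → ∑ h (map (_∷ v) (allFin (suc N)))) (allMaps n (suc N))
      ≡⟨ ∑-cong (λ v → trans (∑-map h (_∷ v) (allFin (suc N))) (∑-allFin-suc (λ c → h (c ∷ v))))
                (allMaps n (suc N)) ⟩
    ∑ (λ v → h (fzero ∷ v) + ∑ (λ c → h (fsuc c ∷ v)) (allFin N)) (allMaps n (suc N))
      ≡⟨ ∑-+ _ _ (allMaps n (suc N)) ⟩
    ∑ (λ v → h (fzero ∷ v)) (allMaps n (suc N)) +
    ∑ (λ v → ∑ (λ c → h (fsuc c ∷ v)) (allFin N)) (allMaps n (suc N))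
      ≡⟨ cong₂ _+_ (∑-allMaps-extendByZero (h ∘ (fzero ∷_))) firstNonzero ⟩
    ∑ FirstOutside (allSubsets n) + ∑ FirstInside (allSubsets n)
      ≡⟨ sym (∑-+ FirstOutside FirstInside (allSubsets n)) ⟩
    ∑ (λ I → FirstOutside I + FirstInside I) (allSubsets n)
      ≡⟨ ∑-cong split (allSubsets n) ⟩
    ∑ (λ I → Extensions (false ∷ I) + (Extensions (true ∷ I) + 0)) (allSubsets n)
      ≡⟨ sym (∑-concatMap Extensions _ (allSubsets n)) ⟩
    ∑ Extensions (allSubsets (suc n)) ∎
    where
    open ≡-Reasoning
    Extensions : Vec Bool (suc n) → ℕ
    Extensions I = ∑ (h ∘ extendByZero I ∘ toList) (allMaps (card I) N)

    FirstOutside FirstInside : Vec Bool n → ℕ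
    FirstOutside I = ∑ (h ∘ extendByZero (false ∷ I) ∘ toList) (allMaps (card I) N)
    FirstInside I = ∑ (λ g → ∑ (λ c → h (extendByZero (true ∷ I) (c ∷ toList g))) (allFin N)) (allMaps (card I) N)

    firstNonzero : ∑ (λ v → ∑ (λ c → h (fsuc c ∷ v)) (allFin N)) (allMaps n (suc N)) ≡
                   ∑ FirstInside (allSubsets n)
    firstNonzero = begin
      ∑ (λ v → ∑ (λ c → h (fsuc c ∷ v)) (allFin N)) (allMaps n (suc N))
        ≡⟨ ∑-swap (λ v c → h (fsuc c ∷ v)) (allMaps n (suc N)) (allFin N) ⟩
      ∑ (λ c → ∑ (λ v → h (fsuc c ∷ v)) (allMaps n (suc N))) (allFin N)
        ≡⟨ ∑-cong (λ c → ∑-allMaps-extendByZero (h ∘ (fsuc c ∷_))) (allFin N) ⟩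
      ∑ (λ c → ∑ (λ I → ∑ (h ∘ (fsuc c ∷_) ∘ extendByZero I ∘ toList) (allMaps (card I) N)) (allSubsets n))
        (allFin N)
        ≡⟨ ∑-swap _ (allFin N) (allSubsets n) ⟩
      ∑ (λ I → ∑ (λ c → ∑ (h ∘ (fsuc c ∷_) ∘ extendByZero I ∘ toList) (allMaps (card I) N)) (allFin N))
        (allSubsets n)
        ≡⟨ ∑-cong (λ I → ∑-swap _ (allFin N) (allMaps (card I) N)) (allSubsets n) ⟩
      ∑ FirstInside (allSubsets n) ∎

    split : ∀ I → FirstOutside I + FirstInside I ≡ Extensions (false ∷ I) + (Extensions (true ∷ I) + 0)
    split I = cong₂ _+_
      (cong (λ k → ∑ (h ∘ extendByZero (false ∷ I) ∘ toList) (allMaps k N)) (sym card-false))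
      (begin
        FirstInside I
          ≡⟨ sym (∑-allMaps-suc {k = card I} (h ∘ extendByZero (true ∷ I))) ⟩
        ∑ (h ∘ extendByZero (true ∷ I) ∘ toList) (allMaps (suc (card I)) N)
          ≡⟨ cong (λ k → ∑ (h ∘ extendByZero (true ∷ I) ∘ toList) (allMaps (suc k) N)) (sym card-false) ⟩
        Extensions (true ∷ I)
          ≡⟨ sym (+-identityʳ _) ⟩
        Extensions (true ∷ I) + 0 ∎)
      where
      card-false : card (false ∷ I) ≡ card I
      card-false = length-map fsuc (elements I)

  proper : Variant → Hypergraph n → Vec (Fin N) n → Bool
  proper cap = properCap
  proper sub = properSub

  count : Variant → Hypergraph n → ℕ → ℕ
  count {n} v G N = length (filterᵇ (proper v G) (allMaps n N))

  proper-extendByZero : ∀ v (G : Hypergraph n) (I : Vec Bool n) (g : Vec (Fin N) (card I)) →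
    proper v G (extendByZero I (toList g)) ≡ proper v (restrict v G I) g ∧ isDiscrete (restrict v G (complement I))
  proper-extendByZero cap = properCap-extendByZero
  proper-extendByZero sub = properSub-extendByZero

  indicator-∧ : ∀ x y → indicator (x ∧ y) ≡ (if y then indicator x else 0)
  indicator-∧ true true = refl
  indicator-∧ true false = refl
  indicator-∧ false true = refl
  indicator-∧ false false = refl

  countWithSupport : Variant → Hypergraph n → ℕ → Vec Bool n → ℕ
  countWithSupport v G N I = if isDiscrete (restrict v G (complement I)) then count v (restrict v G I) N else 0

  count-suc : ∀ v (G : Hypergraph n) N → count v G (suc N) ≡ ∑ (countWithSupport v G N) (allSubsets n)
  count-suc {n} v G N = begin
    count v G (suc N)
      ≡⟨ length-filterᵇ (proper v G) (allMaps n (suc N)) ⟩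
    ∑ (indicator ∘ proper v G) (allMaps n (suc N))
      ≡⟨ ∑-allMaps-extendByZero (indicator ∘ proper v G) ⟩
    ∑ (λ I → ∑ (indicator ∘ proper v G ∘ extendByZero I ∘ toList) (allMaps (card I) N)) (allSubsets n)
      ≡⟨ ∑-cong withSupport (allSubsets n) ⟩
    ∑ (countWithSupport v G N) (allSubsets n) ∎
    where
    open ≡-Reasoning
    withSupport : ∀ I → ∑ (indicator ∘ proper v G ∘ extendByZero I ∘ toList) (allMaps (card I) N) ≡
                        countWithSupport v G N I
    withSupport I = begin
      ∑ (indicator ∘ proper v G ∘ extendByZero I ∘ toList) (allMaps (card I) N)
        ≡⟨ ∑-cong (λ g → trans (cong indicator (proper-extendByZero v G I g)) (indicator-∧ _ discrete))
                  (allMaps (card I) N) ⟩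
      ∑ (λ g → if discrete then indicator (proper v (restrict v G I) g) else 0) (allMaps (card I) N)
        ≡⟨ ∑-if discrete _ (allMaps (card I) N) ⟩
      (if discrete then ∑ (indicator ∘ proper v (restrict v G I)) (allMaps (card I) N) else 0)
        ≡⟨ cong (if discrete then_else 0) (sym (length-filterᵇ (proper v (restrict v G I)) (allMaps (card I) N))) ⟩
      countWithSupport v G N I ∎
      where
      discrete : Bool
      discrete = isDiscrete (restrict v G (complement I))

  allMaps-suc-zero : ∀ n → allMaps (suc n) 0 ≡ []
  allMaps-suc-zero zero = refl
  allMaps-suc-zero (suc n) = cong (concatMap _) (allMaps-suc-zero n)

  proper-empty : ∀ v (G : Hypergraph 0) → T (proper {N = N} v G [])
  proper-empty {N} cap G = properCap⁺ {N = N} G [] λ _ _ {x} → case x of λ ()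
  proper-empty {N} sub G = properSub⁺ {N = N} G [] λ e nt → case proj₁ (proj₂ (isNontrivEdge⁻ G e nt)) of λ ()

  count-zero : ∀ v (G : Hypergraph n) → count v G 0 ≡ (if n ≡ᵇ 0 then 1 else 0)
  count-zero {zero} v G =
    trans (length-filterᵇ (proper v G) ([] ∷ [])) (cong (λ b → indicator b + 0) (Equivalence.to T-≡ (proper-empty v G)))
  count-zero {suc n} v G = cong (length ∘ filterᵇ (proper v G)) (allMaps-suc-zero n)


module Evaluation {c ℓ : Level} (K : Field c ℓ) where
  open Colourings using (∑; count; countWithSupport; count-zero; count-suc)
  open import Data.Nat using (zero; suc; _≡ᵇ_) renaming (_+_ to _+ℕ_)
  open import Data.Bool using (true; false; if_then_else_)
  open import Data.List.Base using (List; []; _∷_; map)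
  open import Function using (_∘_)
  import Relation.Binary.PropositionalEquality as ≡
  open Field K
  open import Relation.Binary.Reasoning.Setoid setoid

  eval-cong : ∀ p {x y} → x ≈ y → eval K p x ≈ eval K p y
  eval-cong [] _ = refl
  eval-cong (a ∷ p) x≈y = +-cong refl (*-cong x≈y (eval-cong p x≈y))

  sumK-cong : ∀ {a} {A : Set a} {f g : A → Carrier} → (∀ x → f x ≈ g x) → (xs : List A) →
              sumK K (map f xs) ≈ sumK K (map g xs)
  sumK-cong f≈g [] = refl
  sumK-cong f≈g (x ∷ xs) = +-cong (f≈g x) (sumK-cong f≈g xs)

  fromℕ-+ : ∀ m n → fromℕ K (m +ℕ n) ≈ fromℕ K m + fromℕ K n
  fromℕ-+ zero n = sym (+-identityˡ _)
  fromℕ-+ (suc m) n = trans (+-cong refl (fromℕ-+ m n)) (sym (+-assoc _ _ _))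

  sumK-fromℕ : ∀ {a} {A : Set a} (h : A → ℕ) (xs : List A) →
               sumK K (map (fromℕ K ∘ h) xs) ≈ fromℕ K (∑ h xs)
  sumK-fromℕ h [] = refl
  sumK-fromℕ h (x ∷ xs) = trans (+-cong refl (sumK-fromℕ h xs)) (sym (fromℕ-+ (h x) _))

  fromℕ-*-boolK : ∀ m b → fromℕ K m * boolK K b ≈ fromℕ K (if b then m else 0)
  fromℕ-*-boolK m true = *-identityʳ _
  fromℕ-*-boolK m false = zeroʳ _

  boolK≈fromℕ : ∀ b → boolK K b ≈ fromℕ K (if b then 1 else 0)
  boolK≈fromℕ true = sym (+-identityʳ 1#)
  boolK≈fromℕ false = refl

  module _ (v : Variant) (φ : ∀ {n} → Hypergraph n → Poly K) (isMorphism : IsDoubleBialgebraMorphism K v φ) where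
    open IsDoubleBialgebraMorphism isMorphism

    eval-fromℕ≈count : ∀ N {n} (G : Hypergraph n) → eval K (φ G) (fromℕ K N) ≈ fromℕ K (count v G N)
    eval-fromℕ≈count zero {n} G = begin
      eval K (φ G) 0#                      ≈⟨ ε-compat G ⟩
      boolK K (n ≡ᵇ 0)                   ≈⟨ boolK≈fromℕ (n ≡ᵇ 0) ⟩
      fromℕ K (if n ≡ᵇ 0 then 1 else 0)  ≡⟨ ≡.cong (fromℕ K) (≡.sym (count-zero v G)) ⟩
      fromℕ K (count v G 0)                ∎
    eval-fromℕ≈count (suc N) {n} G = begin
      eval K (φ G) (1# + fromℕ K N)
        ≈⟨ eval-cong (φ G) (+-comm _ _) ⟩
      eval K (φ G) (fromℕ K N + 1#)
        ≈⟨ Δ-compat G (fromℕ K N) 1# ⟩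
      sumK K (map (λ I → eval K (φ (restrict v G I)) (fromℕ K N) * eval K (φ (restrict v G (complement I))) 1#)
                  (allSubsets n))
        ≈⟨ sumK-cong (λ I → trans (*-cong (eval-fromℕ≈count N (restrict v G I))
                                           (ε'-compat (restrict v G (complement I))))
                                   (fromℕ-*-boolK _ _))
                     (allSubsets n) ⟩
      sumK K (map (fromℕ K ∘ countWithSupport v G N) (allSubsets n))
        ≈⟨ sumK-fromℕ (countWithSupport v G N) (allSubsets n) ⟩
      fromℕ K (∑ (countWithSupport v G N) (allSubsets n))
        ≡⟨ ≡.cong (fromℕ K) (≡.sym (count-suc v G N)) ⟩
      fromℕ K (count v G (suc N)) ∎

proposition2p1 : ∀ {c ℓ : Level} (K : Field c ℓ) → CharZero K →
    (∀ (φ : ∀ {n} → Hypergraph n → Poly K) → IsDoubleBialgebraMorphism K cap φ →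
       ∀ {n} (G : Hypergraph n) (N : ℕ) → 1 ≤ N →
       Field._≈_ K (eval K (φ G) (fromℕ K N)) (fromℕ K (countCap G N)))
    ×
    (∀ (φ : ∀ {n} → Hypergraph n → Poly K) → IsDoubleBialgebraMorphism K sub φ →
       ∀ {n} (G : Hypergraph n) (N : ℕ) → 1 ≤ N →
       Field._≈_ K (eval K (φ G) (fromℕ K N)) (fromℕ K (countSub G N)))
proposition2p1 K _ =
  (λ φ isMorphism G N _ → Evaluation.eval-fromℕ≈count K cap φ isMorphism N G) ,
  (λ φ isMorphism G N _ → Evaluation.eval-fromℕ≈count K sub φ isMorphism N G)
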